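{- Let $\alpha$ and $\tilde\alpha$ be compositions and $i$ a positive integer such that $\tilde\alpha_i\leqslant\alpha_i$ and there exists $l>i$ with $\tilde\alpha_k\geqslant\alpha_k$ for every $k\in[i+1,l]$. Then $c_{i,k}(\tilde\alpha)\leqslant c_{i,k}(\alpha)$ for every $k\in[i+1,l+1]$.
   Context: $[a,b]=\{a,\dots,b\}$. A (weak) composition is a finite sequence of nonnegative integers $(\alpha_1,\dots,\alpha_m)$ with $\alpha_k=0$ for $k>m$. For a composition $\alpha$, a positive integer $i$ and $j\in\mathbb{N}$: $c_{i,j}(\alpha)=0$ if $j\leqslant i+1$; for $j>i+1$, $c_{i,j}(\alpha)=c_{i,j-1}(\alpha)+1$ if $\alpha_{j-1}<\alpha_i-c_{i,j-1}(\alpha)$ and $c_{i,j}(\alpha)=c_{i,j-1}(\alpha)$ otherwise. -}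

module Defs where

open import Data.Nat using (ℕ; zero; suc; _+_; _<_; _≤?_; _<?_)
open import Data.List using (List; []; _∷_)
open import Relation.Nullary using (yes; no)

-- A (weak) composition: a finite list (α₁,…,αₘ), with αₖ = 0 for k > m.
Composition : Set
Composition = List ℕ

-- part α k = αₖ (1-indexed); α₀ is unused and set to 0; αₖ = 0 beyond the length.
part : Composition → ℕ → ℕ
part []       _             = 0
part (a ∷ as) zero          = 0
part (a ∷ as) (suc zero)    = a
part (a ∷ as) (suc (suc k)) = part as (suc k)

-- The integer inequality α_{j-1} < α_i - c_{i,j-1} is written as
-- α_{j-1} + c_{i,j-1} < α_i (equivalent over the integers, avoids truncated subtraction).
c : ℕ → ℕ → Composition → ℕ
c i zero    α = 0
c i (suc j) α with suc j ≤? suc i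
... | yes _ = 0
... | no  _ with part α j + c i j α <? part α i
...   | yes _ = suc (c i j α)
...   | no  _ = c i j α

{-# OPTIONS --safe #-}
module Submission where

open import Defs
open import Data.Nat using (ℕ; zero; suc; _≤_; _<_; _≥_; _+_; z≤n; s≤s; _≤?_; _<?_)
open import Data.Nat.Properties
open import Relation.Nullary using (yes; no; ¬_)

-- The counter of α̃ can only catch up with that of α at a step where
-- α̃ increments and α does not; there  α̃ⱼ + c̃ < α̃ᵢ ≤ αᵢ ≤ αⱼ + c ≤ α̃ⱼ + c,  so c̃ < c.

<-cancel-through : ∀ {x x̃ y ỹ c c̃} → x̃ + c̃ < ỹ → ỹ ≤ y → ¬ (x + c < y) → x ≤ x̃ → c̃ < c
<-cancel-through {x} {x̃} {c = c} {c̃} x̃+c̃<ỹ ỹ≤y x+c≮y x≤x̃ = +-cancelˡ-< x̃ c̃ c (begin-strict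
  x̃ + c̃ <⟨ x̃+c̃<ỹ ⟩
  _     ≤⟨ ỹ≤y ⟩
  _     ≤⟨ ≮⇒≥ x+c≮y ⟩
  x + c ≤⟨ +-monoˡ-≤ c x≤x̃ ⟩
  x̃ + c ∎)
  where open ≤-Reasoning

c-step-antitone : ∀ (α α̃ : Composition) i j → part α̃ i ≤ part α i →
                  (suc i ≤ j → part α j ≤ part α̃ j) →
                  c i j α̃ ≤ c i j α → c i (suc j) α̃ ≤ c i (suc j) α
c-step-antitone α α̃ i j α̃ᵢ≤αᵢ αⱼ≤α̃ⱼ c̃ⱼ≤cⱼ with suc j ≤? suc i
... | yes _ = z≤n
... | no j≰i with part α̃ j + c i j α̃ <? part α̃ i | part α j + c i j α <? part α i
...   | yes _ | yes _ = s≤s c̃ⱼ≤cⱼ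
...   | no _  | no _  = c̃ⱼ≤cⱼ
...   | no _  | yes _ = m≤n⇒m≤1+n c̃ⱼ≤cⱼ
...   | yes p | no ¬p = <-cancel-through p α̃ᵢ≤αᵢ ¬p (αⱼ≤α̃ⱼ (≤-pred (≰⇒> j≰i)))

c-antitone-prefix : ∀ (α α̃ : Composition) i l → part α̃ i ≤ part α i →
                    (∀ k → suc i ≤ k → k ≤ l → part α k ≤ part α̃ k) →
                    ∀ k → k ≤ suc l → c i k α̃ ≤ c i k α
c-antitone-prefix α α̃ i l α̃ᵢ≤αᵢ α≤α̃ zero    _           = z≤n
c-antitone-prefix α α̃ i l α̃ᵢ≤αᵢ α≤α̃ (suc j) (s≤s j≤l) =
  c-step-antitone α α̃ i j α̃ᵢ≤αᵢ (λ i<j → α≤α̃ j i<j j≤l)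
    (c-antitone-prefix α α̃ i l α̃ᵢ≤αᵢ α≤α̃ j (m≤n⇒m≤1+n j≤l))

lemma3p2 : (α α̃ : Composition) (i : ℕ) → 1 ≤ i →
    part α̃ i ≤ part α i →
    (l : ℕ) → i < l → (∀ k → suc i ≤ k → k ≤ l → part α̃ k ≥ part α k) →
    ∀ k → suc i ≤ k → k ≤ suc l → c i k α̃ ≤ c i k α
lemma3p2 α α̃ i _ α̃ᵢ≤αᵢ l _ α≤α̃ k _ k≤1+l = c-antitone-prefix α α̃ i l α̃ᵢ≤αᵢ α≤α̃ k k≤1+l
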